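{- Let $q$ be a prime power, $X$ a subspace of $\mathbb{F}_q^n$ with $M=\mathcal{RE}(X)$ a $k\times n$ matrix with pivotal columns $p_1<\cdots<p_k$ and $\Psi(X)=P$, and let $j$ be an inessential nonpivotal column of $M$ with $p_m<j<p_{m+1}$. Let $Y=\mathcal{RS}(\mathrm{ins}(M,j))$. Then: (i) $X\subseteq Y$; (ii) $\mathcal{L}(Y)=\mathcal{L}(X)\cup\{j\}$; (iii) letting $N$ be the submatrix of $M$ formed by rows $1,\dots,m$ and columns $j+1,\dots,n$, and $N'$ the submatrix of $\mathrm{ins}(M,j)$ formed by rows $1,\dots,m$ and columns $j+1,\dots,n$, for every $S\subseteq\{1,\dots,m\}$ the rows of $N$ indexed by $S$ are linearly independent if and only if the rows of $N'$ indexed by $S$ are; in particular the lexically first bases of the row sets of $N$ and $N'$ have the same index set; (iv) $\Psi(Y)=P$.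
   Context: Vectors in $\mathbb{F}_q^n$ are row vectors; $e_1,\dots,e_n$ the standard basis. $\mathcal{L}(X)=\{j: e_j+\sum_{i>j}\alpha_i e_i\in X\text{ for some }\alpha_i\}$, $\mathcal{R}(X)=\{j: e_j+\sum_{i<j}\alpha_i e_i\in X\text{ for some }\alpha_i\}$, $\Psi(X)=s_1\cdots s_n$ with $s_i=U$ if $i\in\mathcal{L}(X)\setminus\mathcal{R}(X)$, $D$ if $i\in\mathcal{R}(X)\setminus\mathcal{L}(X)$, $H$ otherwise. A $k\times n$ matrix is in rref if every row is nonzero with leading entry $1$ in column $p_i$ for row $i$, $p_1<\cdots<p_k$, and columns $p_1,\dots,p_k$ form the identity (pivotal columns). $\mathcal{RE}(X)$ is the unique rref with row space $X$; $\mathcal{RS}(M)$ is the row space of $M$. For an rref $M$, $C_m[j]$ = first $m$ entries of column $j$, $R_r[i]$ = last $r$ entries of row $i$. Column $j$ is essential if: when nonpivotal with $p_m<j<p_{m+1}$ ($p_0=0,p_{k+1}=n+1$), $C_m[j]\notin\operatorname{span}\{C_m[j+1],\dots,C_m[n]\}$; when $j=p_m$, $R_{n-j}[m]\notin\operatorname{span}\{R_{n-j}[1],\dots,R_{n-j}[m-1]\}$; otherwise inessential. The lexically first basis of rows $r_1,\dots,r_t$ has indices $i_1<\cdots<i_s$: $i_1$ the least index of a nonzero row, $i_{l+1}$ the least index $>i_l$ with $r_{i_{l+1}}\notin\operatorname{span}\{r_{i_1},\dots,r_{i_l}\}$. For $b,c\in\mathbb{F}_q^s$, $\Gamma(b,c)=I_s+b^Tc$.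 Bijections $\phi_s$ of $\mathbb{F}_q^s$: for $d\ne0$, $\mu_d(0)=1$ and $\mu_d(x)=1+dx^{ -1}$ for $x\ne0$; $\phi_1=\mu_{ -1}$; $\phi_{s+1}(b_1,\dots,b_{s+1})=(c_1,\dots,c_s,\mu_\alpha(b_{s+1}))$ with $(c_1,\dots,c_s)=\phi_s(b_1,\dots,b_s)$ and $\alpha=-1-\sum_{i\le s}b_ic_i$. One has $b\phi_s(b)^T\ne-1$, so $\Gamma(b,\phi_s(b))$ is invertible. Insertion $\mathrm{ins}(M,j)$ for an inessential nonpivotal column $j$ with $p_m<j<p_{m+1}$: let $N$ be rows $1,\dots,m$, columns $j+1,\dots,n$ of $M$ and $d=C_m[j]$ (which lies in the column space of $N$). Let $i_1<\cdots<i_s$ index the lexically first basis of the rows of $N$, $N_L$ the submatrix of these rows, $b=(d_{i_1},\dots,d_{i_s})$, $c=\phi_s(b)$, and $a=c\,\Gamma(b,c)^{ -1}N_L\in\mathbb{F}_q^{n-j}$. Insert, after row $m$, the new row with zeros in columns $1,\dots,j-1$, a $1$ in column $j$ and $a$ in columns $j+1,\dots,n$; then for $l=1,\dots,m$ subtract $d_l$ times this new row from row $l$. The result is $\mathrm{ins}(M,j)$. -}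

module Defs where

open import Level using (0ℓ)
open import Data.Nat as ℕ using (ℕ; zero; suc)
open import Data.Nat.Primality using (Prime)
open import Data.Fin as Fin using (Fin; zero; suc; toℕ; fromℕ; inject₁)
open import Data.Fin.Subset using (Subset; _∈_)
open import Data.Product using (Σ; Σ-syntax; ∃; ∃-syntax; _×_; _,_)
open import Data.Empty using (⊥)
open import Data.Unit using (⊤)
open import Data.Vec.Functional using (Vector; insertAt; init; last)
open import Relation.Nullary using (¬_; Dec; yes; no)
open import Relation.Binary.PropositionalEquality using (_≡_; _≢_)
open import Algebra.Structures using (IsCommutativeRing)
open import Function.Bundles using (_↔_)

IsPrimePower : ℕ → Set
IsPrimePower q = ∃[ p ] ∃[ e ] (Prime p × q ≡ p ℕ.^ suc e)

-- A finite field with q elements (propositional equality on the carrier).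
-- _⁻¹ is a multiplicative inverse on nonzero elements (its value at 0 is
-- irrelevant and never used).

record FiniteField (q : ℕ) : Set₁ where
  infixl 7 _*_
  infixl 6 _+_
  infix  8 -_
  field
    Carrier  : Set
    _+_      : Carrier → Carrier → Carrier
    _*_      : Carrier → Carrier → Carrier
    -_       : Carrier → Carrier
    0#       : Carrier
    1#       : Carrier
    _⁻¹      : Carrier → Carrier
    isCommutativeRing : IsCommutativeRing _≡_ _+_ _*_ -_ 0# 1#
    0≢1      : 0# ≢ 1#
    ⁻¹-inverse : ∀ x → x ≢ 0# → x * (x ⁻¹) ≡ 1#
    _≟_      : (x y : Carrier) → Dec (x ≡ y)
    enumeration : Fin q ↔ Carrier

module LinAlg {q : ℕ} (F : FiniteField q) where
  open FiniteField F

  infixl 6 _-_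
  _-_ : Carrier → Carrier → Carrier
  x - y = x + (- y)

  Vec : ℕ → Set
  Vec n = Fin n → Carrier

  Matrix : ℕ → ℕ → Set
  Matrix k n = Fin k → Fin n → Carrier

  sum : ∀ {t} → (Fin t → Carrier) → Carrier
  sum {zero}  f = 0#
  sum {suc t} f = f zero + sum (λ i → f (suc i))

  δ : ∀ {t} → Fin t → Fin t → Carrier
  δ u v with u Fin.≟ v
  ... | yes _ = 1#
  ... | no  _ = 0#

  Subspace : ℕ → Set₁
  Subspace n = Vec n → Set

  RS : ∀ {k n} → Matrix k n → Subspace n
  RS {k} M v = Σ[ c ∈ Vec k ] (∀ l → v l ≡ sum (λ r → c r * M r l))

  𝓛 : ∀ {n} → Subspace n → Fin n → Set
  𝓛 {n} X j = Σ[ v ∈ Vec n ] (X v × v j ≡ 1# × (∀ i → i Fin.< j → v i ≡ 0#))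

  𝓡 : ∀ {n} → Subspace n → Fin n → Set
  𝓡 {n} X j = Σ[ v ∈ Vec n ] (X v × v j ≡ 1# × (∀ i → j Fin.< i → v i ≡ 0#))

  -- Ψ(X), as the relation "the i-th letter of Ψ(X) is s"
  data Letter : Set where
    U D H : Letter

  ΨLetter : ∀ {n} → Subspace n → Fin n → Letter → Set
  ΨLetter X i U = 𝓛 X i × ¬ 𝓡 X i
  ΨLetter X i D = 𝓡 X i × ¬ 𝓛 X i
  ΨLetter X i H = ¬ (𝓛 X i × ¬ 𝓡 X i) × ¬ (𝓡 X i × ¬ 𝓛 X i)

  IsΨ : ∀ {n} → Subspace n → (Fin n → Letter) → Set
  IsΨ X P = ∀ i → ΨLetter X i (P i)

  IsRREF : ∀ {k n} → Matrix k n → (Fin k → Fin n) → Set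
  IsRREF M p =
    (∀ r r' → r Fin.< r' → p r Fin.< p r') ×
    (∀ r → M r (p r) ≡ 1#) ×
    (∀ r l → l Fin.< p r → M r l ≡ 0#) ×
    (∀ r r' → r ≢ r' → M r' (p r) ≡ 0#)

  -- p_m < j < p_{m+1}  (m = number of pivots left of j; rows are
  -- 0-indexed, so "rows 1..m" of the paper are the rows r with toℕ r < m)
  Between : ∀ {k n} → (Fin k → Fin n) → Fin (suc k) → Fin n → Set
  Between p m j = ∀ r → (toℕ r ℕ.< toℕ m → p r Fin.< j)
                      × (toℕ m ℕ.≤ toℕ r → j Fin.< p r)

  InessentialNP : ∀ {k n} → Matrix k n → Fin (suc k) → Fin n → Set
  InessentialNP {k} {n} M m j =
    Σ[ β ∈ Vec n ] ((∀ l → l Fin.≤ j → β l ≡ 0#) ×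
            (∀ r → toℕ r ℕ.< toℕ m → M r j ≡ sum (λ l → β l * M r l)))

  -- Rows of the submatrix formed by rows r (toℕ r < m) and columns l (j < l)
  -- of a family of rows `rows`.  v is in the span of the selected rows:
  InSpanSel : ∀ {k n} → (Fin k → Vec n) → Fin n → (Fin k → Set) → Vec n → Set
  InSpanSel {k} rows j sel v =
    Σ[ β ∈ Vec k ] ((∀ r → ¬ sel r → β r ≡ 0#) ×
            (∀ l → j Fin.< l → v l ≡ sum (λ r → β r * rows r l)))

  LinIndep : ∀ {k n} → (Fin k → Vec n) → Fin n → Subset k → Set
  LinIndep {k} rows j S =
    ∀ (β : Vec k) → (∀ r → ¬ (r ∈ S) → β r ≡ 0#) →
          (∀ l → j Fin.< l → sum (λ r → β r * rows r l) ≡ 0#) →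
          ∀ r → β r ≡ 0#

  IsLexFirstBasis : ∀ {k n} → (Fin k → Vec n) → Fin (suc k) → Fin n →
                    (s : ℕ) → (Fin s → Fin k) → Set
  IsLexFirstBasis rows m j s is =
    (∀ u u' → u Fin.< u' → is u Fin.< is u') ×
    (∀ u → toℕ (is u) ℕ.< toℕ m) ×
    (∀ u → ¬ InSpanSel rows j (λ r → Σ[ u' ∈ Fin s ] (u' Fin.< u × is u' ≡ r)) (rows (is u))) ×
    (∀ r → toℕ r ℕ.< toℕ m → ¬ (Σ[ u ∈ Fin s ] is u ≡ r) →
       InSpanSel rows j (λ r' → r' Fin.< r × Σ[ u ∈ Fin s ] is u ≡ r') (rows r))

  μ : Carrier → Carrier → Carrier
  μ d x with x ≟ 0#
  ... | yes _ = 1#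
  ... | no  _ = 1# + d * (x ⁻¹)

  -- φ_s  (φ_0 is the empty map, so φ_1 = μ_{-1} as in the paper)
  φ : (s : ℕ) → Vec s → Vec s
  φ zero    b = b
  φ (suc s) b = insertAt c (fromℕ s) (μ α (last b))
    where
    c : Vec s
    c = φ s (init b)
    α : Carrier
    α = - 1# - sum (λ i → init b i * c i)

  Γ : ∀ {s} → Vec s → Vec s → Matrix s s
  Γ b c u v = δ u v + b u * c v

  IsInverse : ∀ {s} → Matrix s s → Matrix s s → Set
  IsInverse G A =
    (∀ u v → sum (λ w → G u w * A w v) ≡ δ u v) ×
    (∀ u v → sum (λ w → A u w * G w v) ≡ δ u v)

  dvec : ∀ {k n} → Matrix k n → Fin n → Vec k
  dvec M j r = M r j

  -- ins(M, j), given m, the index set `is` of the lexically first basis of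
  -- the rows of N, and G = Γ(b, φ_s b)⁻¹.
  insRow : ∀ {k n} → Matrix k n → Fin n → (s : ℕ) → (Fin s → Fin k) →
           Matrix s s → Vec n
  insRow M j s is G l with l Fin.<? j | l Fin.≟ j
  ... | yes _ | _     = 0#
  ... | no _  | yes _ = 1#
  ... | no _  | no _  = sum (λ u → sum (λ w → c w * G w u) * M (is u) l)
    where
    b : Vec s
    b u = M (is u) j
    c : Vec s
    c = φ s b

  ins : ∀ {k n} → Matrix k n → Fin (suc k) → Fin n → (s : ℕ) →
        (Fin s → Fin k) → Matrix s s → Matrix (suc k) n
  ins {k} {n} M m j s is G = insertAt M' m new
    where
    new : Vec n
    new = insRow M j s is G
    M' : Matrix k n
    M' r l with toℕ r ℕ.<? toℕ m
    ... | yes _ = M r l - M r j * new l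
    ... | no  _ = M r l

-- Let a be the inserted row (0 before j, 1 at j) and Y = RS (ins M j).  The other rows of
-- ins M j differ from rows of M by multiples of a, so Y = X + ⟨a⟩.  Since j is nonpivotal no
-- vector of X starts at j, and since it is inessential (C_m[j] = Σ β_l C_m[l] over l > j) no
-- vector of X ends at j.  Hence reducing modulo a (for 𝓛) or modulo z = τ a - Σ c_u M_{i_u} (for 𝓡,
-- z ends at j; τ = 1 + c·b is nonzero because Γ(b,c) is invertible) shows that j is the only
-- new leading and trailing position, which gives (ii) and (iv).  For (iii), a combination w
-- of rows 1..m satisfies w N′ = w N - (w·d) a on the columns right of j, and w·d = β·(w N);
-- as β·a = (c Γ⁻¹)·b ≠ 1, w N vanishes there iff w N′ does.

module Submission where

open import Defs
open import Level using (0ℓ)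
open import Data.Nat as ℕ using (ℕ; zero; suc; s≤s)
import Data.Nat.Properties as ℕ
open import Data.Fin as Fin using (Fin; zero; suc; toℕ; inject₁; punchIn; punchOut)
open import Data.Fin.Properties using (suc-injective; <-cmp; <-trans; punchIn-punchOut)
open import Data.Fin.Subset using (Subset; _∈_)
open import Data.Vec.Functional using (insertAt)
open import Data.Vec.Functional.Properties using (insertAt-punchIn; insertAt-lookup)
open import Data.Product using (Σ-syntax; _×_; _,_; proj₁; proj₂)
open import Data.Sum using (_⊎_; inj₁; inj₂; fromInj₁)
open import Data.Empty using (⊥-elim)
open import Function.Base using (flip; _∘_; _∋_)
open import Function.Bundles using (_⇔_; mk⇔; Equivalence)
open import Relation.Nullary using (¬_; yes; no)
open import Relation.Binary.Core using (Rel)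
open import Relation.Binary.Definitions using (Transitive; Trichotomous; tri<; tri≈; tri>)
import Relation.Binary.Construct.Flip.EqAndOrd as Flip
open import Relation.Binary.PropositionalEquality
open import Algebra.Bundles using (CommutativeRing)
import Algebra.Properties.Ring as RingProperties
import Algebra.Properties.CommutativeSemigroup as CommutativeSemigroupProperties
import Algebra.Properties.Semiring.Sum as SemiringSum

punchIn≡inject₁ : ∀ {k} (m : Fin (suc k)) (r : Fin k) → toℕ r ℕ.< toℕ m → punchIn m r ≡ inject₁ r
punchIn≡inject₁ (suc m) zero    _         = refl
punchIn≡inject₁ (suc m) (suc r) (s≤s r<m) = cong suc (punchIn≡inject₁ m r r<m)

module _ {q : ℕ} (F : FiniteField q) where
  open FiniteField F
  open LinAlg F
  open Equivalence using (to; from)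

  commutativeRing : CommutativeRing 0ℓ 0ℓ
  commutativeRing = record { isCommutativeRing = isCommutativeRing }

  open CommutativeRing commutativeRing
    using (+-comm; +-assoc; *-comm; *-assoc; distribˡ; distribʳ; +-identityˡ; +-identityʳ;
           *-identityˡ; *-identityʳ; zeroˡ; zeroʳ; -‿inverseʳ; ring; semiring;
           *-commutativeSemigroup)
  open RingProperties ring
    using (-1*x≈-x; x[y-z]≈xy-xz; [y-z]x≈yx-zx; -‿involutive; -0#≈0#;
           -‿+-comm; x∙y⁻¹≈ε⇒x≈y; //-rightDividesˡ; //-rightDividesʳ)
  open CommutativeSemigroupProperties *-commutativeSemigroup using (x∙yz≈y∙xz)
  private module ∑ = SemiringSum semiring

  x*y≡0⇒y≡0 : ∀ {x y} → x ≢ 0# → x * y ≡ 0# → y ≡ 0#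
  x*y≡0⇒y≡0 {x} {y} x≢0 xy≡0 = begin
    y                ≡⟨ *-identityˡ y ⟨
    1# * y           ≡⟨ cong (_* y) (trans (*-comm (x ⁻¹) x) (⁻¹-inverse x x≢0)) ⟨
    (x ⁻¹ * x) * y   ≡⟨ *-assoc (x ⁻¹) x y ⟩
    x ⁻¹ * (x * y)   ≡⟨ cong (x ⁻¹ *_) xy≡0 ⟩
    x ⁻¹ * 0#        ≡⟨ zeroʳ (x ⁻¹) ⟩
    0#               ∎
    where open ≡-Reasoning

  x≡x*y⇒x≡0 : ∀ {x y} → y ≢ 1# → x ≡ x * y → x ≡ 0#
  x≡x*y⇒x≡0 {x} {y} y≢1 x≡xy = x*y≡0⇒y≡0 1-y≢0 (begin
    (1# - y) * x       ≡⟨ *-comm (1# - y) x ⟩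
    x * (1# - y)       ≡⟨ x[y-z]≈xy-xz x 1# y ⟩
    x * 1# - x * y     ≡⟨ cong (_- x * y) (trans (*-identityʳ x) x≡xy) ⟩
    x * y - x * y      ≡⟨ -‿inverseʳ (x * y) ⟩
    0#                 ∎)
    where
    open ≡-Reasoning
    1-y≢0 : 1# - y ≢ 0#
    1-y≢0 1-y≡0 = y≢1 (sym (x∙y⁻¹≈ε⇒x≈y 1# y 1-y≡0))

  x≡0⇒x*y≡x*z : ∀ {x} y z → x ≡ 0# → x * y ≡ x * z
  x≡0⇒x*y≡x*z {x} y z x≡0 = trans (cong (_* y) x≡0) (trans (zeroˡ y) (sym (trans (cong (_* z) x≡0) (zeroˡ z))))

  sum≡∑ : ∀ {t} (f : Vec t) → sum f ≡ ∑.sum f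
  sum≡∑ {zero}  f = refl
  sum≡∑ {suc t} f = cong (f zero +_) (sum≡∑ (f ∘ suc))

  sum-cong : ∀ {t} {f g : Vec t} → f ≗ g → sum f ≡ sum g
  sum-cong {f = f} {g} f≗g = trans (sum≡∑ f) (trans (∑.sum-cong-≗ {_} {f} {g} f≗g) (sym (sum≡∑ g)))

  sum-zero : ∀ {t} {f : Vec t} → (∀ i → f i ≡ 0#) → sum f ≡ 0#
  sum-zero {t} f≗0 = trans (sum-cong f≗0) (trans (sum≡∑ {t} (λ _ → 0#)) (∑.sum-replicate-zero t))

  sum-distrib-+ : ∀ {t} (f g : Vec t) → sum (λ i → f i + g i) ≡ sum f + sum g
  sum-distrib-+ f g =
    trans (sum≡∑ (λ i → f i + g i)) (trans (∑.∑-distrib-+ f g) (sym (cong₂ _+_ (sum≡∑ f) (sum≡∑ g))))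

  *-distribˡ-sum : ∀ {t} x (f : Vec t) → x * sum f ≡ sum (λ i → x * f i)
  *-distribˡ-sum x f =
    trans (cong (x *_) (sum≡∑ f)) (trans (∑.*-distribˡ-sum x f) (sym (sum≡∑ (λ i → x * f i))))

  *-distribʳ-sum : ∀ {t} x (f : Vec t) → sum f * x ≡ sum (λ i → f i * x)
  *-distribʳ-sum x f =
    trans (cong (_* x) (sum≡∑ f)) (trans (∑.*-distribʳ-sum x f) (sym (sum≡∑ (λ i → f i * x))))

  sum-comm : ∀ {s t} (f : Fin s → Fin t → Carrier) →
             sum (λ u → sum (λ v → f u v)) ≡ sum (λ v → sum (λ u → f u v))
  sum-comm f = begin
    sum (λ u → sum (f u))        ≡⟨ sum-cong (λ u → sum≡∑ (f u)) ⟩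
    sum (λ u → ∑.sum (f u))      ≡⟨ sum≡∑ (λ u → ∑.sum (f u)) ⟩
    ∑.sum (λ u → ∑.sum (f u))    ≡⟨ ∑.∑-comm f ⟩
    ∑.sum (λ v → ∑.sum (flip f v)) ≡⟨ sum≡∑ (λ v → ∑.sum (flip f v)) ⟨
    sum (λ v → ∑.sum (flip f v)) ≡⟨ sum-cong (λ v → sum≡∑ (flip f v)) ⟨
    sum (λ v → sum (flip f v))   ∎
    where open ≡-Reasoning

  sum-distrib-- : ∀ {t} (f g : Vec t) → sum (λ i → f i - g i) ≡ sum f - sum g
  sum-distrib-- f g = begin
    sum (λ i → f i - g i)            ≡⟨ sum-distrib-+ f (λ i → - g i) ⟩
    sum f + sum (λ i → - g i)        ≡⟨ cong (sum f +_) (sum-cong (λ i → -1*x≈-x (g i))) ⟨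
    sum f + sum (λ i → - 1# * g i)   ≡⟨ cong (sum f +_) (*-distribˡ-sum (- 1#) g) ⟨
    sum f + - 1# * sum g             ≡⟨ cong (sum f +_) (-1*x≈-x (sum g)) ⟩
    sum f - sum g                    ∎
    where open ≡-Reasoning

  sum-single : ∀ {t} (f : Vec t) r → (∀ i → i ≢ r → f i ≡ 0#) → sum f ≡ f r
  sum-single f zero    f≡0 = trans (cong (f zero +_) (sum-zero (λ i → f≡0 (suc i) λ ()))) (+-identityʳ _)
  sum-single f (suc r) f≡0 = trans (cong (_+ sum (f ∘ suc)) (f≡0 zero λ ()))
    (trans (+-identityˡ _) (sum-single (f ∘ suc) r (λ i i≢r → f≡0 (suc i) (i≢r ∘ suc-injective))))

  δ-refl : ∀ {t} (u : Fin t) → δ u u ≡ 1#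
  δ-refl u with u Fin.≟ u
  ... | yes _   = refl
  ... | no u≢u  = ⊥-elim (u≢u refl)

  δ-≢ : ∀ {t} {u v : Fin t} → u ≢ v → δ u v ≡ 0#
  δ-≢ {u = u} {v} u≢v with u Fin.≟ v
  ... | yes u≡v = ⊥-elim (u≢v u≡v)
  ... | no _    = refl

  sum-δˡ : ∀ {t} r (f : Vec t) → sum (λ i → δ r i * f i) ≡ f r
  sum-δˡ r f = trans (sum-single _ r (λ i i≢r → trans (cong (_* f i) (δ-≢ (i≢r ∘ sym))) (zeroˡ _)))
                     (trans (cong (_* f r) (δ-refl r)) (*-identityˡ _))

  sum-δʳ : ∀ {t} r (f : Vec t) → sum (λ i → f i * δ i r) ≡ f r
  sum-δʳ r f = trans (sum-single _ r (λ i i≢r → trans (cong (f i *_) (δ-≢ i≢r)) (zeroʳ _)))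
                     (trans (cong (f r *_) (δ-refl r)) (*-identityʳ _))

  sum-punchIn : ∀ {t} (f : Vec (suc t)) i → sum f ≡ f i + sum (f ∘ punchIn i)
  sum-punchIn f i = trans (sum≡∑ f) (trans (∑.sum-remove {i = i} f) (cong (f i +_) (sym (sum≡∑ (f ∘ punchIn i)))))

  x-y*0≡x : ∀ x y → x - y * 0# ≡ x
  x-y*0≡x x y = trans (cong (λ u → x - u) (zeroʳ y)) (trans (cong (x +_) -0#≈0#) (+-identityʳ x))

  x-0*y≡x : ∀ x y → x - 0# * y ≡ x
  x-0*y≡x x y = trans (cong (λ u → x - u) (zeroˡ y)) (trans (cong (x +_) -0#≈0#) (+-identityʳ x))

  x-[y-z]≡[x-y]+z : ∀ x y z → x - (y - z) ≡ (x - y) + z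
  x-[y-z]≡[x-y]+z x y z = begin
    x - (y - z)        ≡⟨ cong (x +_) (-‿+-comm y (- z)) ⟨
    x + (- y + - - z)  ≡⟨ cong (λ u → x + (- y + u)) (-‿involutive z) ⟩
    x + (- y + z)      ≡⟨ +-assoc x (- y) z ⟨
    (x - y) + z        ∎
    where open ≡-Reasoning

  -x≡0⇒x≡0 : ∀ {x} → - x ≡ 0# → x ≡ 0#
  -x≡0⇒x≡0 {x} -x≡0 = trans (sym (-‿involutive x)) (trans (cong -_ -x≡0) -0#≈0#)

  infix 7 _·_
  _·_ : ∀ {t} → Vec t → Vec t → Carrier
  x · y = sum (λ i → x i * y i)

  lincomb : ∀ {k n} → Vec k → (Fin k → Vec n) → Vec n
  lincomb c A l = sum (λ r → c r * A r l)

  *-lincomb : ∀ {k n} a (g : Vec k) (A : Fin k → Vec n) l → a * lincomb g A l ≡ lincomb (λ r → a * g r) A l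
  *-lincomb a g A l = trans (*-distribˡ-sum a (λ r → g r * A r l)) (sum-cong (λ r → sym (*-assoc a (g r) (A r l))))

  ·-lincomb : ∀ {k n} (x : Vec n) (g : Vec k) (A : Fin k → Vec n) → x · lincomb g A ≡ g · (λ r → x · A r)
  ·-lincomb x g A = begin
    sum (λ l → x l * lincomb g A l)              ≡⟨ sum-cong (λ l → *-distribˡ-sum (x l) (λ r → g r * A r l)) ⟩
    sum (λ l → sum (λ r → x l * (g r * A r l)))  ≡⟨ sum-comm (λ l r → x l * (g r * A r l)) ⟩
    sum (λ r → sum (λ l → x l * (g r * A r l)))  ≡⟨ sum-cong (λ r → sum-cong (λ l → x∙yz≈y∙xz (x l) (g r) (A r l))) ⟩
    sum (λ r → sum (λ l → g r * (x l * A r l)))  ≡⟨ sum-cong (λ r → *-distribˡ-sum (g r) (λ l → x l * A r l)) ⟨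
    g · (λ r → x · A r)                          ∎
    where open ≡-Reasoning

  lincomb-assoc : ∀ {k t n} (c : Vec k) (A : Matrix k t) (B : Matrix t n) l →
                  lincomb (lincomb c A) B l ≡ lincomb c (λ r → lincomb (A r) B) l
  lincomb-assoc c A B l = begin
    sum (λ w → lincomb c A w * B w l)              ≡⟨ sum-cong (λ w → *-distribʳ-sum (B w l) (λ r → c r * A r w)) ⟩
    sum (λ w → sum (λ r → (c r * A r w) * B w l))  ≡⟨ sum-comm (λ w r → (c r * A r w) * B w l) ⟩
    sum (λ r → sum (λ w → (c r * A r w) * B w l))  ≡⟨ sum-cong (λ r → sum-cong (λ w → *-assoc (c r) (A r w) (B w l))) ⟩
    sum (λ r → sum (λ w → c r * (A r w * B w l)))  ≡⟨ sum-cong (λ r → *-distribˡ-sum (c r) (λ w → A r w * B w l)) ⟨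
    lincomb c (λ r → lincomb (A r) B) l            ∎
    where open ≡-Reasoning

  lincomb-shift : ∀ {k n} (w : Vec k) (A : Fin k → Vec n) (d : Vec k) (y : Vec n) l →
                  lincomb w (λ r l → A r l - d r * y l) l ≡ lincomb w A l - (w · d) * y l
  lincomb-shift w A d y l = begin
    sum (λ r → w r * (A r l - d r * y l))                   ≡⟨ sum-cong distribute ⟩
    sum (λ r → w r * A r l - (w r * d r) * y l)             ≡⟨ sum-distrib-- (λ r → w r * A r l) (λ r → (w r * d r) * y l) ⟩
    lincomb w A l - sum (λ r → (w r * d r) * y l)
      ≡⟨ cong (λ u → lincomb w A l - u) (*-distribʳ-sum (y l) (λ r → w r * d r)) ⟨
    lincomb w A l - (w · d) * y l                           ∎
    where
    open ≡-Reasoning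
    distribute : ∀ r → w r * (A r l - d r * y l) ≡ w r * A r l - (w r * d r) * y l
    distribute r = trans (x[y-z]≈xy-xz (w r) (A r l) (d r * y l)) (cong (λ u → w r * A r l - u) (sym (*-assoc (w r) (d r) (y l))))

  lincomb-δ : ∀ {k n} (g : Vec k) (A : Fin k → Vec n) r₀ l → lincomb (λ r → g r - δ r₀ r) A l ≡ lincomb g A l - A r₀ l
  lincomb-δ g A r₀ l = begin
    sum (λ r → (g r - δ r₀ r) * A r l)                      ≡⟨ sum-cong (λ r → [y-z]x≈yx-zx (A r l) (g r) (δ r₀ r)) ⟩
    sum (λ r → g r * A r l - δ r₀ r * A r l)                ≡⟨ sum-distrib-- (λ r → g r * A r l) (λ r → δ r₀ r * A r l) ⟩
    lincomb g A l - sum (λ r → δ r₀ r * A r l)              ≡⟨ cong (λ u → lincomb g A l - u) (sum-δˡ r₀ (λ r → A r l)) ⟩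
    lincomb g A l - A r₀ l                                  ∎
    where open ≡-Reasoning

  record IsSubspace {n} (X : Subspace n) : Set where
    field
      ≗-closed : ∀ {v w} → v ≗ w → X v → X w
      0-closed : X (λ _ → 0#)
      +-closed : ∀ {v w} → X v → X w → X (λ l → v l + w l)
      *-closed : ∀ a {v} → X v → X (λ l → a * v l)

    diff-closed : ∀ {v w} → X v → X w → X (λ l → v l - w l)
    diff-closed {w = w} Xv Xw = +-closed Xv (≗-closed (λ l → -1*x≈-x (w l)) (*-closed (- 1#) Xw))

    lincomb-closed : ∀ {k} (c : Vec k) {A : Fin k → Vec n} → (∀ r → X (A r)) → X (lincomb c A)
    lincomb-closed {zero}  c XA = 0-closed
    lincomb-closed {suc k} c XA = +-closed (*-closed (c zero) (XA zero)) (lincomb-closed (c ∘ suc) (XA ∘ suc))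

    -- Replacing the direction w by a * w - x₀ with x₀ ∈ X: take s = t / a.
    rebase : ∀ {a t} {v w x₀ : Vec n} → a ≢ 0# → X x₀ → X (λ l → v l - t * w l) →
             X (λ l → v l - (t * a ⁻¹) * (a * w l - x₀ l))
    rebase {a} {t} {v} {w} {x₀} a≢0 Xx₀ Xv-tw =
      ≗-closed (λ l → sym (rebased l)) (+-closed Xv-tw (*-closed s Xx₀))
      where
      s : Carrier
      s = t * a ⁻¹
      s*a≡t : s * a ≡ t
      s*a≡t = trans (*-assoc t (a ⁻¹) a) (trans (cong (t *_) (trans (*-comm (a ⁻¹) a) (⁻¹-inverse a a≢0))) (*-identityʳ t))
      rebased : ∀ l → v l - s * (a * w l - x₀ l) ≡ (v l - t * w l) + s * x₀ l
      rebased l = begin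
        v l - s * (a * w l - x₀ l)          ≡⟨ cong (λ u → v l - u) (x[y-z]≈xy-xz s (a * w l) (x₀ l)) ⟩
        v l - (s * (a * w l) - s * x₀ l)
          ≡⟨ cong (λ u → v l - (u - s * x₀ l)) (trans (sym (*-assoc s a (w l))) (cong (λ x → x * w l) s*a≡t)) ⟩
        v l - (t * w l - s * x₀ l)          ≡⟨ x-[y-z]≡[x-y]+z (v l) (t * w l) (s * x₀ l) ⟩
        (v l - t * w l) + s * x₀ l          ∎
        where open ≡-Reasoning

  RS-isSubspace : ∀ {k n} (A : Matrix k n) → IsSubspace (RS A)
  RS-isSubspace A = record
    { ≗-closed = λ { v≗w (c , v≗cA) → c , λ l → trans (sym (v≗w l)) (v≗cA l) }
    ; 0-closed = (λ _ → 0#) , λ l → sym (sum-zero (λ r → zeroˡ (A r l)))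
    ; +-closed = λ { (c , v≗cA) (c′ , w≗c′A) → (λ r → c r + c′ r) , λ l →
        trans (cong₂ _+_ (v≗cA l) (w≗c′A l))
              (trans (sym (sum-distrib-+ (λ r → c r * A r l) (λ r → c′ r * A r l)))
                     (sum-cong (λ r → sym (distribʳ (A r l) (c r) (c′ r))))) }
    ; *-closed = λ a → λ { (c , v≗cA) → (λ r → a * c r) , λ l →
        trans (cong (a *_) (v≗cA l)) (*-lincomb a c A l) }
    }

  RS-row : ∀ {k n} (A : Matrix k n) r → RS A (A r)
  RS-row A r = δ r , λ l → sym (sum-δˡ r (λ i → A i l))

  RS-least : ∀ {k n} {X : Subspace n} → IsSubspace X → (A : Matrix k n) → (∀ r → X (A r)) →
             ∀ {v} → RS A v → X v
  RS-least X-sub A XA (c , v≗cA) = ≗-closed (λ l → sym (v≗cA l)) (lincomb-closed c XA)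
    where open IsSubspace X-sub

  -- RS A′ = RS A + ⟨w⟩ when the rows of A′ are w and the rows of A shifted by multiples of w.
  module AdjoinRow {k n} (A : Matrix k n) (A′ : Matrix (suc k) n) (m : Fin (suc k))
                   (w : Vec n) (d : Vec k) (A′-m : A′ m ≗ w)
                   (A′-punchIn : ∀ r → A′ (punchIn m r) ≗ λ l → A r l - d r * w l) where

    private
      module X′ = IsSubspace (RS-isSubspace A′)

      B : Matrix (suc k) n
      B = insertAt A m w

      module B = IsSubspace (RS-isSubspace B)

      RS-B-reduce : ∀ {v} → RS B v → Σ[ t ∈ Carrier ] RS A (λ l → v l - t * w l)
      RS-B-reduce {v} (c , v≗cB) = c m , c ∘ punchIn m , λ l → begin
        v l - c m * w l                                        ≡⟨ cong (_- c m * w l) (v≗cB l) ⟩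
        lincomb c B l - c m * w l                              ≡⟨ cong (_- c m * w l) (sum-punchIn (λ ρ → c ρ * B ρ l) m) ⟩
        (c m * B m l + lincomb (c ∘ punchIn m) (B ∘ punchIn m) l) - c m * w l
          ≡⟨ cong (_- c m * w l) (+-comm _ _) ⟩
        (lincomb (c ∘ punchIn m) (B ∘ punchIn m) l + c m * B m l) - c m * w l
          ≡⟨ cong₂ (λ x y → (x + c m * y) - c m * w l)
                   (sum-cong (λ r → cong (c (punchIn m r) *_) (cong-app (insertAt-punchIn A m w r) l)))
                   (cong-app (insertAt-lookup A m w) l) ⟩
        (lincomb (c ∘ punchIn m) A l + c m * w l) - c m * w l  ≡⟨ //-rightDividesʳ (c m * w l) _ ⟩
        lincomb (c ∘ punchIn m) A l                            ∎
        where open ≡-Reasoning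

    adjoined∈RS′ : RS A′ w
    adjoined∈RS′ = X′.≗-closed A′-m (RS-row A′ m)

    RS⊆RS′ : ∀ {v} → RS A v → RS A′ v
    RS⊆RS′ = RS-least (RS-isSubspace A′) A λ r →
      X′.≗-closed (λ l → //-rightDividesˡ (d r * w l) (A r l))
                  (X′.+-closed (X′.≗-closed (A′-punchIn r) (RS-row A′ (punchIn m r))) (X′.*-closed (d r) adjoined∈RS′))

    RS′-reduce : ∀ {v} → RS A′ v → Σ[ t ∈ Carrier ] RS A (λ l → v l - t * w l)
    RS′-reduce = RS-B-reduce ∘ RS-least (RS-isSubspace B) A′ rows∈RS-B
      where
      rows∈RS-B : ∀ ρ → RS B (A′ ρ)
      rows∈RS-B ρ with m Fin.≟ ρ
      ... | yes refl = B.≗-closed (λ l → trans (cong-app (insertAt-lookup A m w) l) (sym (A′-m l))) (RS-row B m)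
      ... | no m≢ρ = subst (RS B ∘ A′) (punchIn-punchOut m≢ρ)
        (B.≗-closed (λ l → sym (A′-punchIn r l))
          (B.diff-closed (B.≗-closed (λ l → cong-app (insertAt-punchIn A m w r) l) (RS-row B (punchIn m r)))
                      (B.*-closed (d r) (B.≗-closed (λ l → cong-app (insertAt-lookup A m w) l) (RS-row B m)))))
        where r = punchOut m≢ρ

  module _ {k n} (M : Matrix k n) (j : Fin n) (s : ℕ) (is : Fin s → Fin k) (G : Matrix s s) where

    insRow-left : ∀ l → l Fin.< j → insRow M j s is G l ≡ 0#
    insRow-left l l<j with l Fin.<? j
    ... | yes _   = refl
    ... | no l≮j  = ⊥-elim (l≮j l<j)

    insRow-pivot : insRow M j s is G j ≡ 1#
    insRow-pivot with j Fin.<? j | j Fin.≟ j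
    ... | yes j<j | _       = ⊥-elim (ℕ.<-irrefl refl j<j)
    ... | no _    | yes _   = refl
    ... | no _    | no j≢j  = ⊥-elim (j≢j refl)

    insRow-right : ∀ l → j Fin.< l →
                   insRow M j s is G l ≡ lincomb (lincomb (φ s (λ u → M (is u) j)) G) (M ∘ is) l
    insRow-right l j<l with l Fin.<? j | l Fin.≟ j
    ... | yes l<j | _      = ⊥-elim (ℕ.<-asym j<l l<j)
    ... | no _    | yes refl = ⊥-elim (ℕ.<-irrefl refl j<l)
    ... | no _    | no _   = refl

    module _ (m : Fin (suc k)) where

      ins-at-m : ins M m j s is G m ≗ insRow M j s is G
      ins-at-m = cong-app (insertAt-lookup _ m _)

      ins-upper-row : ∀ r → toℕ r ℕ.< toℕ m →
                          ins M m j s is G (punchIn m r) ≗ λ l → M r l - M r j * insRow M j s is G l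
      ins-upper-row r r<m l rewrite cong-app ((ins M m j s is G (punchIn m r) ≡ _) ∋ insertAt-punchIn _ m _ r) l
        with toℕ r ℕ.<? toℕ m
      ... | yes _   = refl
      ... | no r≮m  = ⊥-elim (r≮m r<m)

      ins-lower-row : ∀ r → ¬ (toℕ r ℕ.< toℕ m) → ins M m j s is G (punchIn m r) ≗ M r
      ins-lower-row r r≮m l rewrite cong-app ((ins M m j s is G (punchIn m r) ≡ _) ∋ insertAt-punchIn _ m _ r) l
        with toℕ r ℕ.<? toℕ m
      ... | yes r<m = ⊥-elim (r≮m r<m)
      ... | no _    = refl

  module RankOneInverse {s} (b c : Vec s) (G : Matrix s s)
                        (ΓG≡I : ∀ u v → lincomb (Γ b c u) G v ≡ δ u v) where

    τ : Carrier
    τ = 1# + c · b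

    cG : Vec s
    cG = lincomb c G

    cΓ≡τc : ∀ v → lincomb c (Γ b c) v ≡ τ * c v
    cΓ≡τc v = begin
      sum (λ w → c w * (δ w v + b w * c v))               ≡⟨ sum-cong (λ w → distribˡ (c w) (δ w v) (b w * c v)) ⟩
      sum (λ w → c w * δ w v + c w * (b w * c v))         ≡⟨ sum-distrib-+ (λ w → c w * δ w v) (λ w → c w * (b w * c v)) ⟩
      sum (λ w → c w * δ w v) + sum (λ w → c w * (b w * c v))
        ≡⟨ cong₂ _+_ (sum-δʳ v c) (trans (sum-cong (λ w → sym (*-assoc (c w) (b w) (c v))))
                                         (sym (*-distribʳ-sum (c v) (λ w → c w * b w)))) ⟩
      c v + (c · b) * c v                                 ≡⟨ cong (_+ (c · b) * c v) (*-identityˡ (c v)) ⟨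
      1# * c v + (c · b) * c v                            ≡⟨ distribʳ (c v) 1# (c · b) ⟨
      τ * c v                                             ∎
      where open ≡-Reasoning

    τ*cG≡c : ∀ u → τ * cG u ≡ c u
    τ*cG≡c u = begin
      τ * lincomb c G u                         ≡⟨ *-lincomb τ c G u ⟩
      lincomb (λ w → τ * c w) G u               ≡⟨ sum-cong (λ w → cong (_* G w u) (cΓ≡τc w)) ⟨
      lincomb (lincomb c (Γ b c)) G u           ≡⟨ lincomb-assoc c (Γ b c) G u ⟩
      lincomb c (λ v → lincomb (Γ b c v) G) u   ≡⟨ sum-cong (λ v → cong (c v *_) (ΓG≡I v u)) ⟩
      sum (λ v → c v * δ v u)                   ≡⟨ sum-δʳ u c ⟩
      c u                                       ∎
      where open ≡-Reasoning

    -- τ = 0 would force c = τ cG = 0, hence τ = 1.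
    τ≢0 : τ ≢ 0#
    τ≢0 τ≡0 = 0≢1 (sym (begin
      1#            ≡⟨ +-identityʳ 1# ⟨
      1# + 0#       ≡⟨ cong (1# +_) (sum-zero (λ w → trans (cong (_* b w) (c≡0 w)) (zeroˡ (b w)))) ⟨
      τ             ≡⟨ τ≡0 ⟩
      0#            ∎))
      where
      open ≡-Reasoning
      c≡0 : ∀ u → c u ≡ 0#
      c≡0 u = trans (sym (τ*cG≡c u)) (trans (cong (_* cG u) τ≡0) (zeroˡ (cG u)))

    cG·b≢1 : cG · b ≢ 1#
    cG·b≢1 cG·b≡1 = 0≢1 (sym (begin
      1#                    ≡⟨ //-rightDividesʳ (c · b) 1# ⟨
      τ - c · b             ≡⟨ cong (_- c · b) (trans (sym (*-identityʳ τ)) (cong (τ *_) (sym cG·b≡1))) ⟩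
      τ * (cG · b) - c · b  ≡⟨ cong (_- c · b) τ*[cG·b]≡c·b ⟩
      c · b - c · b         ≡⟨ -‿inverseʳ (c · b) ⟩
      0#                    ∎))
      where
      open ≡-Reasoning
      τ*[cG·b]≡c·b : τ * (cG · b) ≡ c · b
      τ*[cG·b]≡c·b = trans (*-distribˡ-sum τ (λ u → cG u * b u))
                           (sum-cong (λ u → trans (sym (*-assoc τ (cG u) (b u))) (cong (_* b u) (τ*cG≡c u))))

  module Relations {k n} (m : Fin (suc k)) (j : Fin n) where

    Supported : Vec k → Set
    Supported w = ∀ r → ¬ (toℕ r ℕ.< toℕ m) → w r ≡ 0#

    IsRelation : (Fin k → Vec n) → Vec k → Set
    IsRelation A w = ∀ l → j Fin.< l → lincomb w A l ≡ 0#

    Relations⊆ : (A B : Fin k → Vec n) → Set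
    Relations⊆ A B = ∀ w → Supported w → IsRelation A w → IsRelation B w

    module _ {A B : Fin k → Vec n} (A⊆B : Relations⊆ A B) where

      InSpanSel-transfer : ∀ {sel} → (∀ r → sel r → toℕ r ℕ.< toℕ m) → ∀ r₀ → toℕ r₀ ℕ.< toℕ m →
                           InSpanSel A j sel (A r₀) → InSpanSel B j sel (B r₀)
      InSpanSel-transfer {sel} sel<m r₀ r₀<m (g , g-sel , A-r₀≡gA) =
        g , g-sel , λ l j<l →
          sym (x∙y⁻¹≈ε⇒x≈y _ _ (trans (sym (lincomb-δ g B r₀ l)) (A⊆B w w-supp A-rel l j<l)))
        where
        w : Vec k
        w r = g r - δ r₀ r
        w-supp : Supported w
        w-supp r r≮m = trans (cong₂ _-_ (g-sel r (r≮m ∘ sel<m r))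
                                        (δ-≢ λ r₀≡r → r≮m (subst (λ x → toℕ x ℕ.< toℕ m) r₀≡r r₀<m)))
                             (-‿inverseʳ 0#)
        A-rel : IsRelation A w
        A-rel l j<l = trans (lincomb-δ g A r₀ l)
                            (trans (cong (_- A r₀ l) (sym (A-r₀≡gA l j<l))) (-‿inverseʳ (A r₀ l)))

      LinIndep-transfer : ∀ S → (∀ r → r ∈ S → toℕ r ℕ.< toℕ m) → LinIndep B j S → LinIndep A j S
      LinIndep-transfer S S<m indepB w w∉S A-rel = indepB w w∉S (A⊆B w (λ r r≮m → w∉S r (r≮m ∘ S<m r)) A-rel)

    IsLexFirstBasis-transfer : ∀ {A B} → Relations⊆ A B → Relations⊆ B A → ∀ t (js : Fin t → Fin k) →
                               IsLexFirstBasis A m j t js → IsLexFirstBasis B m j t js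
    IsLexFirstBasis-transfer A⊆B B⊆A t js (increasing , js<m , independent , spanning) =
      increasing , js<m ,
      (λ u inSpan → independent u (InSpanSel-transfer B⊆A (earlier<m u) (js u) (js<m u) inSpan)) ,
      (λ r r<m r∉js → InSpanSel-transfer A⊆B (λ r′ r′<r → ℕ.<-trans (proj₁ r′<r) r<m) r r<m (spanning r r<m r∉js))
      where
      earlier<m : ∀ u r → Σ[ u′ ∈ Fin t ] (u′ Fin.< u × js u′ ≡ r) → toℕ r ℕ.< toℕ m
      earlier<m u r (u′ , _ , js-u′≡r) = subst (λ x → toℕ x ℕ.< toℕ m) js-u′≡r (js<m u′)

  module RREF {k n} (M : Matrix k n) (p : Fin k → Fin n) (rref : IsRREF M p)
              (j : Fin n) (m : Fin (suc k)) (btw : Between p m j) where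

    private
      M-pivot : ∀ r → M r (p r) ≡ 1#
      M-pivot = proj₁ (proj₂ rref)
      M-before-pivot : ∀ r l → l Fin.< p r → M r l ≡ 0#
      M-before-pivot = proj₁ (proj₂ (proj₂ rref))
      M-pivot-column : ∀ r r′ → r ≢ r′ → M r′ (p r) ≡ 0#
      M-pivot-column = proj₂ (proj₂ (proj₂ rref))

    lincomb-at-pivot : ∀ c r → lincomb c M (p r) ≡ c r
    lincomb-at-pivot c r =
      trans (sum-single _ r (λ r′ r′≢r → trans (cong (c r′ *_) (M-pivot-column r r′ (r′≢r ∘ sym))) (zeroʳ (c r′))))
            (trans (cong (c r *_) (M-pivot r)) (*-identityʳ (c r)))

    lower-row-at-j : ∀ r → ¬ (toℕ r ℕ.< toℕ m) → M r j ≡ 0#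
    lower-row-at-j r r≮m = M-before-pivot r j (proj₂ (btw r) (ℕ.≮⇒≥ r≮m))

    RS-zero-before-j : ∀ {x} → RS M x → (∀ l → l Fin.< j → x l ≡ 0#) → x j ≡ 0#
    RS-zero-before-j {x} (c , x≗cM) x-before = trans (x≗cM j) (sum-zero term)
      where
      term : ∀ r → c r * M r j ≡ 0#
      term r with toℕ r ℕ.<? toℕ m
      ... | yes r<m = trans (cong (_* M r j) (trans (sym (lincomb-at-pivot c r))
                              (trans (sym (x≗cM (p r))) (x-before (p r) (proj₁ (btw r) r<m))))) (zeroˡ (M r j))
      ... | no r≮m  = trans (cong (c r *_) (lower-row-at-j r r≮m)) (zeroʳ (c r))

  module Inessential {k n} (M : Matrix k n) (p : Fin k → Fin n) (rref : IsRREF M p)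
                     (j : Fin n) (m : Fin (suc k)) (btw : Between p m j) (iness : InessentialNP M m j) where

    open RREF M p rref j m btw
    open Relations m j

    β : Vec n
    β = proj₁ iness

    private
      β-up-to-j : ∀ l → l Fin.≤ j → β l ≡ 0#
      β-up-to-j = proj₁ (proj₂ iness)

    column-j≡β· : ∀ r → toℕ r ℕ.< toℕ m → M r j ≡ β · M r
    column-j≡β· = proj₂ (proj₂ iness)

    β·-cong : ∀ {x y : Vec n} → (∀ l → j Fin.< l → x l ≡ y l) → β · x ≡ β · y
    β·-cong {x} {y} x≡y = sum-cong term
      where
      term : ∀ l → β l * x l ≡ β l * y l
      term l with l Fin.≤? j
      ... | yes l≤j = x≡0⇒x*y≡x*z (x l) (y l) (β-up-to-j l l≤j)
      ... | no l≰j  = cong (β l *_) (x≡y l (ℕ.≰⇒> l≰j))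

    β·-zero : ∀ {x : Vec n} → (∀ l → j Fin.< l → x l ≡ 0#) → β · x ≡ 0#
    β·-zero x≡0 = trans (β·-cong x≡0) (sum-zero (λ l → zeroʳ (β l)))

    lincomb-column-j : ∀ w → Supported w → lincomb w M j ≡ β · lincomb w M
    lincomb-column-j w w-supp = trans (sum-cong term) (sym (·-lincomb β w M))
      where
      term : ∀ r → w r * M r j ≡ w r * (β · M r)
      term r with toℕ r ℕ.<? toℕ m
      ... | yes r<m = cong (w r *_) (column-j≡β· r r<m)
      ... | no r≮m  = x≡0⇒x*y≡x*z (M r j) (β · M r) (w-supp r r≮m)

    RS-zero-after-j : ∀ {x} → RS M x → (∀ l → j Fin.< l → x l ≡ 0#) → x j ≡ 0#
    RS-zero-after-j {x} (c , x≗cM) x-after = begin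
      x j                 ≡⟨ x≗cM j ⟩
      lincomb c M j       ≡⟨ lincomb-column-j c c-supp ⟩
      β · lincomb c M     ≡⟨ β·-cong (λ l _ → sym (x≗cM l)) ⟩
      β · x               ≡⟨ β·-zero x-after ⟩
      0#                  ∎
      where
      open ≡-Reasoning
      c-supp : Supported c
      c-supp r r≮m = trans (sym (lincomb-at-pivot c r))
                           (trans (sym (x≗cM (p r))) (x-after (p r) (proj₂ (btw r) (ℕ.≮⇒≥ r≮m))))

  -- 𝓛 X and 𝓡 X are Leading Fin._<_ X and Leading (flip Fin._<_) X.
  Leading : ∀ {n} → Rel (Fin n) 0ℓ → Subspace n → Fin n → Set
  Leading {n} _≺_ X i = Σ[ v ∈ Vec n ] (X v × v i ≡ 1# × (∀ l → l ≺ i → v l ≡ 0#))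

  ¬Leading-gap : ∀ {n} (_≺_ : Rel (Fin n) 0ℓ) {X : Subspace n} {j} →
                 (∀ {x} → X x → (∀ l → l ≺ j → x l ≡ 0#) → x j ≡ 0#) → ¬ Leading _≺_ X j
  ¬Leading-gap _≺_ X-gap (x , Xx , x-j≡1 , x-before) = 0≢1 (trans (sym (X-gap Xx x-before)) x-j≡1)

  Leading-adjoin : ∀ {n} (_≺_ : Rel (Fin n) 0ℓ) → Transitive _≺_ → Trichotomous _≡_ _≺_ →
                   ∀ {X Y : Subspace n} {j e} → IsSubspace X →
                   (∀ {x} → X x → (∀ l → l ≺ j → x l ≡ 0#) → x j ≡ 0#) → (∀ {v} → X v → Y v) →
                   Y e → e j ≡ 1# → (∀ l → l ≺ j → e l ≡ 0#) →
                   (∀ {v} → Y v → Σ[ t ∈ Carrier ] X (λ l → v l - t * e l)) →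
                   ∀ i → Leading _≺_ Y i ⇔ (Leading _≺_ X i ⊎ i ≡ j)
  Leading-adjoin _≺_ ≺-trans ≺-cmp {X} {Y} {j} {e} X-sub X-gap X⊆Y Ye e-j≡1 e-before Y-reduce i = mk⇔ reduce adjoin
    where
    open IsSubspace X-sub

    adjoin : Leading _≺_ X i ⊎ i ≡ j → Leading _≺_ Y i
    adjoin (inj₁ (v , Xv , v-i≡1 , v-before)) = v , X⊆Y Xv , v-i≡1 , v-before
    adjoin (inj₂ refl)                      = e , Ye , e-j≡1 , e-before

    reduce : Leading _≺_ Y i → Leading _≺_ X i ⊎ i ≡ j
    reduce (y , Yy , y-i≡1 , y-before) with Y-reduce Yy | ≺-cmp i j
    ... | _     | tri≈ _ i≡j _ = inj₂ i≡j
    ... | t , X[y-te] | tri< i≺j _ _ =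
      inj₁ ((λ l → y l - t * e l) , X[y-te] ,
            trans (cong (λ u → y i - t * u) (e-before i i≺j)) (trans (x-y*0≡x (y i) t) y-i≡1) ,
            λ l l≺i → trans (cong (λ u → y l - t * u) (e-before l (≺-trans l≺i i≺j)))
                            (trans (x-y*0≡x (y l) t) (y-before l l≺i)))
    ... | t , X[y-te] | tri> _ _ j≺i =
      inj₁ (y , ≗-closed (λ l → trans (cong (λ u → y l - u * e l) t≡0) (x-0*y≡x (y l) (e l))) X[y-te] ,
            y-i≡1 , y-before)
      where
      -- y - t e vanishes before j, so its entry - t at j is zero by the gap.
      t≡0 : t ≡ 0#
      t≡0 = -x≡0⇒x≡0 (begin
        - t                ≡⟨ +-identityˡ (- t) ⟨
        0# - t             ≡⟨ cong₂ (λ u v → u - v) (y-before j j≺i) (trans (cong (t *_) e-j≡1) (*-identityʳ t)) ⟨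
        y j - t * e j      ≡⟨ X-gap X[y-te] y-te-before ⟩
        0#                 ∎)
        where
        open ≡-Reasoning
        y-te-before : ∀ l → l ≺ j → y l - t * e l ≡ 0#
        y-te-before l l≺j = trans (cong₂ (λ u v → u - t * v) (y-before l (≺-trans l≺j j≺i)) (e-before l l≺j))
                                  (x-y*0≡x 0# t)

  ΨLetter-resp : ∀ {n} {X Y : Subspace n} {i} → 𝓛 X i ⇔ 𝓛 Y i → 𝓡 X i ⇔ 𝓡 Y i →
                 ∀ s → ΨLetter X i s → ΨLetter Y i s
  ΨLetter-resp 𝓛⇔ 𝓡⇔ U (𝓛X , ¬𝓡X) = to 𝓛⇔ 𝓛X , ¬𝓡X ∘ from 𝓡⇔
  ΨLetter-resp 𝓛⇔ 𝓡⇔ D (𝓡X , ¬𝓛X) = to 𝓡⇔ 𝓡X , ¬𝓛X ∘ from 𝓛⇔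
  ΨLetter-resp 𝓛⇔ 𝓡⇔ H (¬U , ¬D)   = (λ (𝓛Y , ¬𝓡Y) → ¬U (from 𝓛⇔ 𝓛Y , ¬𝓡Y ∘ to 𝓡⇔)) ,
                                     (λ (𝓡Y , ¬𝓛Y) → ¬D (from 𝓡⇔ 𝓡Y , ¬𝓛Y ∘ to 𝓛⇔))

  IsΨ-adjoin : ∀ {n} {X Y : Subspace n} {j} →
               (∀ i → 𝓛 Y i ⇔ (𝓛 X i ⊎ i ≡ j)) → (∀ i → 𝓡 Y i ⇔ (𝓡 X i ⊎ i ≡ j)) →
               ¬ 𝓛 X j → ¬ 𝓡 X j →
               ∀ P → IsΨ X P → IsΨ Y P
  IsΨ-adjoin {X = X} {Y} {j} 𝓛Y⇔ 𝓡Y⇔ ¬𝓛Xj ¬𝓡Xj P ΨX i with i Fin.≟ j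
  ... | yes refl = at-j (P i) (ΨX i)
    where
    at-j : ∀ s → ΨLetter X i s → ΨLetter Y i s
    at-j U (𝓛Xj , _) = ⊥-elim (¬𝓛Xj 𝓛Xj)
    at-j D (𝓡Xj , _) = ⊥-elim (¬𝓡Xj 𝓡Xj)
    at-j H _         = (λ (_ , ¬𝓡Yj) → ¬𝓡Yj (from (𝓡Y⇔ i) (inj₂ refl))) ,
                       (λ (_ , ¬𝓛Yj) → ¬𝓛Yj (from (𝓛Y⇔ i) (inj₂ refl)))
  ... | no i≢j = ΨLetter-resp (restrict (𝓛Y⇔ i)) (restrict (𝓡Y⇔ i)) (P i) (ΨX i)
    where
    restrict : ∀ {A B : Set} → B ⇔ (A ⊎ i ≡ j) → A ⇔ B
    restrict B⇔A⊎ = mk⇔ (from B⇔A⊎ ∘ inj₁) (fromInj₁ (⊥-elim ∘ i≢j) ∘ to B⇔A⊎)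

  module Insertion {k n} (M : Matrix k n) (p : Fin k → Fin n) (rref : IsRREF M p)
                   (j : Fin n) (m : Fin (suc k)) (btw : Between p m j) (iness : InessentialNP M m j)
                   (s : ℕ) (is : Fin s → Fin k) (is<m : ∀ u → toℕ (is u) ℕ.< toℕ m) (G : Matrix s s)
                   (ΓG≡I : ∀ u v → lincomb (Γ (λ u → M (is u) j) (φ s (λ u → M (is u) j)) u) G v ≡ δ u v) where

    open RREF M p rref j m btw
    open Inessential M p rref j m btw iness
    open Relations m j

    b : Vec s
    b u = M (is u) j

    c : Vec s
    c = φ s b

    open RankOneInverse b c G ΓG≡I

    new : Vec n
    new = insRow M j s is G

    M′ : Matrix (suc k) n
    M′ = ins M m j s is G

    ins-row : ∀ r → M′ (punchIn m r) ≗ λ l → M r l - M r j * new l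
    ins-row r with toℕ r ℕ.<? toℕ m
    ... | yes r<m = ins-upper-row M j s is G m r r<m
    ... | no r≮m  = λ l → trans (ins-lower-row M j s is G m r r≮m l)
      (sym (trans (cong (λ u → M r l - u * new l) (lower-row-at-j r r≮m)) (x-0*y≡x (M r l) (new l))))

    open AdjoinRow M M′ m new (λ r → M r j) (ins-at-m M j s is G m) ins-row public

    private
      module X = IsSubspace (RS-isSubspace M)
      module Y = IsSubspace (RS-isSubspace M′)

    new-right : ∀ l → j Fin.< l → new l ≡ lincomb cG (M ∘ is) l
    new-right = insRow-right M j s is G

    β·new≡cG·b : β · new ≡ cG · b
    β·new≡cG·b = begin
      β · new                      ≡⟨ β·-cong new-right ⟩
      β · lincomb cG (M ∘ is)      ≡⟨ ·-lincomb β cG (M ∘ is) ⟩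
      cG · (λ u → β · M (is u))    ≡⟨ sum-cong (λ u → cong (cG u *_) (column-j≡β· (is u) (is<m u))) ⟨
      cG · b                       ∎
      where open ≡-Reasoning

    x₀ : Vec n
    x₀ = lincomb c (M ∘ is)

    -- z witnesses j ∈ 𝓡 (RS M′): right of j, τ * new is exactly x₀, while z j = τ - c · b = 1.
    z : Vec n
    z l = τ * new l - x₀ l

    z∈RS′ : RS M′ z
    z∈RS′ = Y.diff-closed (Y.*-closed τ adjoined∈RS′) (RS⊆RS′ (X.lincomb-closed c (RS-row M ∘ is)))

    z-j : z j ≡ 1#
    z-j = trans (cong (λ u → τ * u - c · b) (insRow-pivot M j s is G))
                (trans (cong (_- c · b) (*-identityʳ τ)) (//-rightDividesʳ (c · b) 1#))

    z-right : ∀ l → j Fin.< l → z l ≡ 0#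
    z-right l j<l = trans (cong (λ u → τ * u - x₀ l) (new-right l j<l))
                          (trans (cong (_- x₀ l) τ*new≡x₀) (-‿inverseʳ (x₀ l)))
      where
      τ*new≡x₀ : τ * lincomb cG (M ∘ is) l ≡ x₀ l
      τ*new≡x₀ = trans (*-lincomb τ cG (M ∘ is) l) (sum-cong (λ u → cong (_* M (is u) l) (τ*cG≡c u)))

    RS′-reduce-z : ∀ {v} → RS M′ v → Σ[ t ∈ Carrier ] RS M (λ l → v l - t * z l)
    RS′-reduce-z RS′v with RS′-reduce RS′v
    ... | t , RS[v-t·new] = t * τ ⁻¹ , X.rebase τ≢0 (X.lincomb-closed c (RS-row M ∘ is)) RS[v-t·new]

    𝓛-ins : ∀ i → 𝓛 (RS M′) i ⇔ (𝓛 (RS M) i ⊎ i ≡ j)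
    𝓛-ins = Leading-adjoin Fin._<_ <-trans <-cmp (RS-isSubspace M) RS-zero-before-j RS⊆RS′
              adjoined∈RS′ (insRow-pivot M j s is G) (insRow-left M j s is G) RS′-reduce

    𝓡-ins : ∀ i → 𝓡 (RS M′) i ⇔ (𝓡 (RS M) i ⊎ i ≡ j)
    𝓡-ins = Leading-adjoin (flip Fin._<_) (Flip.trans Fin._<_ <-trans) (Flip.compare Fin._<_ <-cmp)
              (RS-isSubspace M) RS-zero-after-j RS⊆RS′ z∈RS′ z-j z-right RS′-reduce-z

    ¬𝓛-j : ¬ 𝓛 (RS M) j
    ¬𝓛-j = ¬Leading-gap Fin._<_ RS-zero-before-j

    ¬𝓡-j : ¬ 𝓡 (RS M) j
    ¬𝓡-j = ¬Leading-gap (flip Fin._<_) RS-zero-after-j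

    N′ : Fin k → Vec n
    N′ r = M′ (inject₁ r)

    lincomb-N′ : ∀ w → Supported w → ∀ l → lincomb w N′ l ≡ lincomb w M l - lincomb w M j * new l
    lincomb-N′ w w-supp l = trans (sum-cong term) (lincomb-shift w M (λ r → M r j) new l)
      where
      term : ∀ r → w r * N′ r l ≡ w r * (M r l - M r j * new l)
      term r with toℕ r ℕ.<? toℕ m
      ... | yes r<m = trans (cong (λ ρ → w r * M′ ρ l) (sym (punchIn≡inject₁ m r r<m)))
                            (cong (w r *_) (ins-row r l))
      ... | no r≮m  = x≡0⇒x*y≡x*z (N′ r l) _ (w-supp r r≮m)

    relations-M⊆N′ : Relations⊆ M N′
    relations-M⊆N′ w w-supp rel l j<l = begin
      lincomb w N′ l                           ≡⟨ lincomb-N′ w w-supp l ⟩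
      lincomb w M l - lincomb w M j * new l    ≡⟨ cong₂ (λ u v → u - v * new l) (rel l j<l) wd≡0 ⟩
      0# - 0# * new l                          ≡⟨ x-0*y≡x 0# (new l) ⟩
      0#                                       ∎
      where
      open ≡-Reasoning
      wd≡0 : lincomb w M j ≡ 0#
      wd≡0 = trans (lincomb-column-j w w-supp) (β·-zero rel)

    -- A relation of N′ makes w M proportional to new right of j, with factor wd = w·d;
    -- applying β gives wd = wd (cG · b), and cG · b ≠ 1.
    relations-N′⊆M : Relations⊆ N′ M
    relations-N′⊆M w w-supp rel l j<l = trans (wM≡wd*new l j<l) (trans (cong (_* new l) wd≡0) (zeroˡ (new l)))
      where
      open ≡-Reasoning
      wd : Carrier
      wd = lincomb w M j
      wM≡wd*new : ∀ l → j Fin.< l → lincomb w M l ≡ wd * new l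
      wM≡wd*new l j<l = x∙y⁻¹≈ε⇒x≈y _ _ (trans (sym (lincomb-N′ w w-supp l)) (rel l j<l))
      wd≡0 : wd ≡ 0#
      wd≡0 = x≡x*y⇒x≡0 cG·b≢1 (begin
        wd                               ≡⟨ lincomb-column-j w w-supp ⟩
        β · lincomb w M                  ≡⟨ β·-cong wM≡wd*new ⟩
        sum (λ l → β l * (wd * new l))   ≡⟨ sum-cong (λ l → x∙yz≈y∙xz (β l) wd (new l)) ⟩
        sum (λ l → wd * (β l * new l))   ≡⟨ *-distribˡ-sum wd (λ l → β l * new l) ⟨
        wd * (β · new)                   ≡⟨ cong (wd *_) β·new≡cG·b ⟩
        wd * (cG · b)                    ∎)

mainTheorem7 :
  (q : ℕ) → IsPrimePower q → (F : FiniteField q) →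
  let open LinAlg F in
  {k n : ℕ} (M : Matrix k n) (p : Fin k → Fin n) → IsRREF M p →
  (j : Fin n) (m : Fin (suc k)) → Between p m j → InessentialNP M m j →
  (s : ℕ) (is : Fin s → Fin k) → IsLexFirstBasis M m j s is →
  (G : Matrix s s) → IsInverse G (Γ (λ u → M (is u) j) (φ s (λ u → M (is u) j))) →
  let M′ = ins M m j s is G
      X = RS M
      Y = RS M′
      N′ = λ (r : Fin k) → M′ (inject₁ r)
  in
  (∀ v → X v → Y v) ×
  (∀ i → 𝓛 Y i ⇔ (𝓛 X i ⊎ i ≡ j)) ×
  (∀ (S : Subset k) → (∀ r → r ∈ S → toℕ r ℕ.< toℕ m) →
     LinIndep M j S ⇔ LinIndep N′ j S) ×
  (∀ (t : ℕ) (js : Fin t → Fin k) →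
     IsLexFirstBasis M m j t js ⇔ IsLexFirstBasis N′ m j t js) ×
  (∀ (P : Fin n → Letter) → IsΨ X P → IsΨ Y P)
mainTheorem7 q _ F M p rref j m btw iness s is lfb G inv =
  (λ _ → RS⊆RS′) ,
  𝓛-ins ,
  (λ S S<m → mk⇔ (LinIndep-transfer relations-N′⊆M S S<m) (LinIndep-transfer relations-M⊆N′ S S<m)) ,
  (λ t js → mk⇔ (IsLexFirstBasis-transfer relations-M⊆N′ relations-N′⊆M t js)
                (IsLexFirstBasis-transfer relations-N′⊆M relations-M⊆N′ t js)) ,
  IsΨ-adjoin F 𝓛-ins 𝓡-ins ¬𝓛-j ¬𝓡-j
  where
  open Insertion F M p rref j m btw iness s is (proj₁ (proj₂ lfb)) G (proj₂ inv)
  open Relations F m j
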